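{- Let $M=x^2+x+1\in\mathbb{F}_2[x]$, $r\ge1$, $u\ge1$, and $A=(M^{2^r}+\cdots+M+1)^{2^u}$. Then $\ell_A=2^u(2^r-1)+1$.
   Context: For nonzero $A\in\mathbb{F}_2[x]$, the Collatz transformations are: $A_0=A$, and for $k\ge0$, $A_{2k+1}=A_{2k}/(x^{a_{2k}}(x+1)^{b_{2k}})$ where $a_{2k},b_{2k}$ are the multiplicities of $x$ and $x+1$ in $A_{2k}$, and $A_{2k+2}=1+MA_{2k+1}$. The length $\ell_A$ is $1+\min\{k\ge0: A_{2k+1}=1\}$, i.e. the number of terms of the sequence $A_1,A_3,A_5,\dots$ up to and including its first term equal to $1$. -}

module Defs where

open import Data.Bool using (Bool; true; false; _xor_; if_then_else_)
open import Data.List using (List; []; _∷_; length)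
open import Data.Nat using (ℕ; zero; suc; _<_)
open import Data.Product using (∃; _×_; _,_)
open import Relation.Binary.PropositionalEquality using (_≡_)
open import Relation.Nullary using (¬_)

-- Polynomials over F₂: coefficient lists, lowest degree first.
-- Trailing zero coefficients are allowed; equality of polynomials is _≈_.
Poly : Set
Poly = List Bool

norm : Poly → Poly
norm [] = []
norm (a ∷ p) with norm p
... | [] = if a then true ∷ [] else []
... | q@(_ ∷ _) = a ∷ q

infix 4 _≈_
_≈_ : Poly → Poly → Set
p ≈ q = norm p ≡ norm q

infixl 6 _⊕_
_⊕_ : Poly → Poly → Poly
[] ⊕ q = q
(a ∷ p) ⊕ [] = a ∷ p
(a ∷ p) ⊕ (b ∷ q) = (a xor b) ∷ (p ⊕ q)

infixl 7 _⊗_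
_⊗_ : Poly → Poly → Poly
[] ⊗ q = []
(a ∷ p) ⊗ q = (if a then q else []) ⊕ (false ∷ (p ⊗ q))

one : Poly
one = true ∷ []

M : Poly
M = true ∷ true ∷ true ∷ []

infixr 8 _^^_
_^^_ : Poly → ℕ → Poly
p ^^ zero = one
p ^^ suc n = p ⊗ (p ^^ n)

geomM : ℕ → Poly
geomM zero = one
geomM (suc n) = (M ^^ suc n) ⊕ geomM n

-- Division by (x+1): for p = a₀ + a₁x + ⋯ + aₙxⁿ, returns (q , r) with
-- p = (1+x)·q + r, r ∈ F₂ (q_i = a₀ ⊕ ⋯ ⊕ a_i, r = a₀ ⊕ ⋯ ⊕ aₙ).
divX1 : Bool → Poly → Poly × Bool
divX1 acc [] = [] , acc
divX1 acc (a ∷ []) = [] , (acc xor a)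
divX1 acc (a ∷ b ∷ p) with divX1 (acc xor a) (b ∷ p)
... | (q , r) = ((acc xor a) ∷ q) , r

-- Remove all factors x and x+1 from a polynomial (the odd step
-- A ↦ A / (x^a (x+1)^b)).  Fuel: each round lowers the degree, so
-- length p rounds suffice.
stripFuel : ℕ → Poly → Poly
stripFuel zero p = p
stripFuel (suc f) p with norm p
... | [] = []
... | false ∷ r = stripFuel f r
... | q@(true ∷ _) with divX1 false q
...   | (d , false) = stripFuel f d
...   | (d , true) = q

strip : Poly → Poly
strip p = stripFuel (length p) p

-- one full Collatz step  A_{2k} ↦ A_{2k+2} = 1 + M · A_{2k+1}
step : Poly → Poly
step A = one ⊕ (M ⊗ strip A)

evenTerm : ℕ → Poly → Poly
evenTerm zero A = A
evenTerm (suc k) A = step (evenTerm k A)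

oddTerm : ℕ → Poly → Poly
oddTerm k A = strip (evenTerm k A)

CollatzLength : Poly → ℕ → Set
CollatzLength A n =
  ∃ λ m → n ≡ suc m × oddTerm m A ≈ one × (∀ k → k < m → ¬ (oddTerm k A ≈ one))

-- Write M + 1 = x² + x = x(x + 1) and Ω j e = 1 + (M + 1)ʲ Mᵉ.  In characteristic 2 the
-- Frobenius map gives M^(2^t) = 1 + (M + 1)^(2^t), hence M^(2^r) + ⋯ + M + 1 = 1 + (M + 1)^(2^r - 1) M
-- and A = Ω m 2ᵘ with m = 2ᵘ(2ʳ - 1).  For j ≥ 1, Ω j e takes the value 1 at 0 and at 1, so it is
-- its own odd part, and 1 + M · Ω (j + 1) e = (M + 1) · Ω j (e + 1).  Thus the k-th odd term is
-- Ω (m - k) (2ᵘ + k) ≠ 1 for k < m, while the next even term is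
-- (M + 1)(1 + M^(2^(u+r))) = (M + 1)^(2^(u+r) + 1), whose odd part is 1.

module Submission where

open import Defs
open import Algebra.Bundles using (CommutativeSemigroup; CommutativeSemiring; CommutativeRing)
open import Algebra.Structures using (IsCommutativeMonoid)
open import Algebra.Structures.Biased using (isCommutativeSemiringˡ)
import Algebra.Properties.CommutativeSemigroup as CommutativeSemigroupProperties
import Algebra.Solver.Ring.NaturalCoefficients.Default as SemiringSolver
open import Data.Bool using (Bool; true; false; _xor_; _∧_; if_then_else_)
open import Data.Bool.Properties
  using ( xor-comm; xor-assoc; xor-identityʳ; xor-same; ∧-assoc; ∧-zeroʳ; ∧-distribˡ-xor; ∧-distribʳ-xor
        ; xor-∧-commutativeRing)
open import Data.Empty using (⊥; ⊥-elim)
open import Data.List using ([]; _∷_; length)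
open import Data.Nat using (ℕ; zero; suc; _+_; _*_; _^_; _∸_; _<_; _≤_; _≥_; z≤n; s≤s)
open import Data.Nat.Properties
  using (+-identityʳ; +-suc; +-comm; *-zeroʳ; *-suc; *-comm; ≤-pred; ≤-trans; ≤-refl; m+[n∸m]≡n
        ; *-mono-≤; ∸-monoˡ-≤; ^-monoʳ-≤; m^n>0; ^-distribˡ-+-*)
open import Data.Product using (_×_; _,_; proj₁; proj₂)
open import Relation.Binary.Bundles using (Setoid)
open import Relation.Binary.Structures using (IsEquivalence)
open import Relation.Binary.PropositionalEquality
  using (_≡_; refl; sym; trans; cong; cong₂; subst)
open import Relation.Nullary using (¬_)

-- The semiring 𝔽₂[x]

coeff : Poly → ℕ → Bool
coeff []      _       = false
coeff (a ∷ p) zero    = a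
coeff (a ∷ p) (suc i) = coeff p i

infix 4 _≃_
record _≃_ (p q : Poly) : Set where
  constructor coeffwise
  field coeff-≡ : ∀ i → coeff p i ≡ coeff q i
open _≃_

≃-reflexive : ∀ {p q} → p ≡ q → p ≃ q
≃-reflexive refl = coeffwise λ _ → refl

≃-refl : ∀ {p} → p ≃ p
≃-refl = ≃-reflexive refl

≃-sym : ∀ {p q} → p ≃ q → q ≃ p
≃-sym h = coeffwise λ i → sym (coeff-≡ h i)

≃-trans : ∀ {p q r} → p ≃ q → q ≃ r → p ≃ r
≃-trans h k = coeffwise λ i → trans (coeff-≡ h i) (coeff-≡ k i)

≃-isEquivalence : IsEquivalence _≃_
≃-isEquivalence = record { refl = ≃-refl ; sym = ≃-sym ; trans = ≃-trans }

≃-setoid : Setoid _ _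
≃-setoid = record { isEquivalence = ≃-isEquivalence }

open import Relation.Binary.Reasoning.Setoid ≃-setoid

∷-cong : ∀ {a b p q} → a ≡ b → p ≃ q → a ∷ p ≃ b ∷ q
∷-cong a≡b p≃q = coeffwise λ { zero → a≡b ; (suc i) → coeff-≡ p≃q i }

∷-injectiveʳ : ∀ {a b p q} → a ∷ p ≃ b ∷ q → p ≃ q
∷-injectiveʳ h = coeffwise λ i → coeff-≡ h (suc i)

∷-≃[] : ∀ {a p} → a ≡ false → p ≃ [] → a ∷ p ≃ []
∷-≃[] a≡false p≃[] = coeffwise λ { zero → a≡false ; (suc i) → coeff-≡ p≃[] i }

∷-≃[]-tail : ∀ {a p} → a ∷ p ≃ [] → p ≃ []
∷-≃[]-tail h = coeffwise λ i → coeff-≡ h (suc i)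

coeff-⊕ : ∀ p q i → coeff (p ⊕ q) i ≡ coeff p i xor coeff q i
coeff-⊕ []      q       i       = refl
coeff-⊕ (a ∷ p) []      i       = sym (xor-identityʳ _)
coeff-⊕ (a ∷ p) (b ∷ q) zero    = refl
coeff-⊕ (a ∷ p) (b ∷ q) (suc i) = coeff-⊕ p q i

⊕-cong : ∀ {p p′ q q′} → p ≃ p′ → q ≃ q′ → p ⊕ q ≃ p′ ⊕ q′
⊕-cong {p} {p′} {q} {q′} h k = coeffwise λ i →
  trans (coeff-⊕ p q i) (trans (cong₂ _xor_ (coeff-≡ h i) (coeff-≡ k i)) (sym (coeff-⊕ p′ q′ i)))

⊕-assoc : ∀ p q r → (p ⊕ q) ⊕ r ≡ p ⊕ (q ⊕ r)
⊕-assoc []      q       r       = refl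
⊕-assoc (a ∷ p) []      r       = refl
⊕-assoc (a ∷ p) (b ∷ q) []      = refl
⊕-assoc (a ∷ p) (b ∷ q) (c ∷ r) = cong₂ _∷_ (xor-assoc a b c) (⊕-assoc p q r)

⊕-comm : ∀ p q → p ⊕ q ≡ q ⊕ p
⊕-comm []      []      = refl
⊕-comm []      (b ∷ q) = refl
⊕-comm (a ∷ p) []      = refl
⊕-comm (a ∷ p) (b ∷ q) = cong₂ _∷_ (xor-comm a b) (⊕-comm p q)

⊕-identityʳ : ∀ p → p ⊕ [] ≡ p
⊕-identityʳ []      = refl
⊕-identityʳ (a ∷ p) = refl

⊕-self : ∀ p → p ⊕ p ≃ []
⊕-self []      = ≃-refl
⊕-self (a ∷ p) = ∷-≃[] (xor-same a) (⊕-self p)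

⊕-self-⊕ : ∀ p q → (p ⊕ p) ⊕ q ≃ q
⊕-self-⊕ p q = ⊕-cong (⊕-self p) ≃-refl

⊕-moveˡ : ∀ {p q r} → p ⊕ q ≃ r → q ≃ p ⊕ r
⊕-moveˡ {p} {q} {r} h = begin
  q             ≈⟨ ⊕-self-⊕ p q ⟨
  (p ⊕ p) ⊕ q   ≡⟨ ⊕-assoc p p q ⟩
  p ⊕ (p ⊕ q)   ≈⟨ ⊕-cong ≃-refl h ⟩
  p ⊕ r         ∎

⊕-≃[]⇒≃ : ∀ {p q} → p ⊕ q ≃ [] → p ≃ q
⊕-≃[]⇒≃ {p} {q} h =
  ≃-trans (⊕-moveˡ (≃-trans (≃-reflexive (⊕-comm q p)) h)) (≃-reflexive (⊕-identityʳ q))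

⊕-isCommutativeMonoid : IsCommutativeMonoid _≃_ _⊕_ []
⊕-isCommutativeMonoid = record
  { isMonoid = record
    { isSemigroup = record
      { isMagma = record { isEquivalence = ≃-isEquivalence ; ∙-cong = ⊕-cong }
      ; assoc   = λ p q r → ≃-reflexive (⊕-assoc p q r) }
    ; identity = (λ _ → ≃-refl) , (λ p → ≃-reflexive (⊕-identityʳ p)) }
  ; comm = λ p q → ≃-reflexive (⊕-comm p q) }

⊕-commutativeSemigroup : CommutativeSemigroup _ _
⊕-commutativeSemigroup = record
  { isCommutativeSemigroup = IsCommutativeMonoid.isCommutativeSemigroup ⊕-isCommutativeMonoid }

open CommutativeSemigroupProperties ⊕-commutativeSemigroup
  using () renaming (interchange to ⊕-interchange)

infixr 7 _•_
_•_ : Bool → Poly → Poly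
a • q = if a then q else []

•-distribʳ-xor : ∀ a b q → (a xor b) • q ≃ a • q ⊕ b • q
•-distribʳ-xor true  true  q = ≃-sym (⊕-self q)
•-distribʳ-xor true  false q = ≃-reflexive (sym (⊕-identityʳ q))
•-distribʳ-xor false b     q = ≃-refl

•-distribˡ-⊕ : ∀ a q r → a • (q ⊕ r) ≡ a • q ⊕ a • r
•-distribˡ-⊕ true  q r = refl
•-distribˡ-⊕ false q r = refl

•-⊗ : ∀ a q r → (a • q) ⊗ r ≡ a • (q ⊗ r)
•-⊗ true  q r = refl
•-⊗ false q r = refl

∷-as-⊕ : ∀ a q → a ∷ q ≡ a • one ⊕ (false ∷ q)
∷-as-⊕ true  q = refl
∷-as-⊕ false q = refl

⊗-zeroʳ : ∀ p → p ⊗ [] ≃ []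
⊗-zeroʳ []          = ≃-refl
⊗-zeroʳ (true ∷ p)  = ∷-≃[] refl (⊗-zeroʳ p)
⊗-zeroʳ (false ∷ p) = ∷-≃[] refl (⊗-zeroʳ p)

≃[]-⊗ : ∀ {p} q → p ≃ [] → p ⊗ q ≃ []
≃[]-⊗ {[]}    q h = ≃-refl
≃[]-⊗ {a ∷ p} q h =
  ⊕-cong (≃-reflexive (cong (_• q) (coeff-≡ h 0))) (∷-≃[] refl (≃[]-⊗ q (∷-≃[]-tail h)))

⊗-congˡ : ∀ {p p′} q → p ≃ p′ → p ⊗ q ≃ p′ ⊗ q
⊗-congˡ {[]}    q h = ≃-sym (≃[]-⊗ q (≃-sym h))
⊗-congˡ {a ∷ p} {[]}     q h = ≃[]-⊗ q h
⊗-congˡ {a ∷ p} {b ∷ p′} q h =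
  ⊕-cong (≃-reflexive (cong (_• q) (coeff-≡ h 0))) (∷-cong refl (⊗-congˡ q (∷-injectiveʳ h)))

⊗-congʳ : ∀ p {q q′} → q ≃ q′ → p ⊗ q ≃ p ⊗ q′
⊗-congʳ []          h = ≃-refl
⊗-congʳ (true ∷ p)  h = ⊕-cong h (∷-cong refl (⊗-congʳ p h))
⊗-congʳ (false ∷ p) h = ∷-cong refl (⊗-congʳ p h)

⊗-cong : ∀ {p p′ q q′} → p ≃ p′ → q ≃ q′ → p ⊗ q ≃ p′ ⊗ q′
⊗-cong {p′ = p′} {q} h k = ≃-trans (⊗-congˡ q h) (⊗-congʳ p′ k)

⊗-distribʳ : ∀ p q r → (p ⊕ q) ⊗ r ≃ p ⊗ r ⊕ q ⊗ r
⊗-distribʳ []      q       r = ≃-refl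
⊗-distribʳ (a ∷ p) []      r = ≃-reflexive (sym (⊕-identityʳ _))
⊗-distribʳ (a ∷ p) (b ∷ q) r =
  ≃-trans (⊕-cong (•-distribʳ-xor a b r) (∷-cong refl (⊗-distribʳ p q r)))
          (⊕-interchange (a • r) (b • r) (false ∷ p ⊗ r) (false ∷ q ⊗ r))

⊗-distribˡ : ∀ p q r → p ⊗ (q ⊕ r) ≃ p ⊗ q ⊕ p ⊗ r
⊗-distribˡ []      q r = ≃-refl
⊗-distribˡ (a ∷ p) q r =
  ≃-trans (⊕-cong (≃-reflexive (•-distribˡ-⊕ a q r)) (∷-cong refl (⊗-distribˡ p q r)))
          (⊕-interchange (a • q) (a • r) (false ∷ p ⊗ q) (false ∷ p ⊗ r))

⊗-shiftʳ : ∀ p q → p ⊗ (false ∷ q) ≃ false ∷ p ⊗ q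
⊗-shiftʳ []          q = ≃-sym (∷-≃[] refl ≃-refl)
⊗-shiftʳ (true ∷ p)  q = ∷-cong refl (⊕-cong ≃-refl (⊗-shiftʳ p q))
⊗-shiftʳ (false ∷ p) q = ∷-cong refl (⊗-shiftʳ p q)

⊗-identityˡ : ∀ p → one ⊗ p ≃ p
⊗-identityˡ p = ≃-trans (⊕-cong ≃-refl (∷-≃[] refl ≃-refl)) (≃-reflexive (⊕-identityʳ p))

⊗-identityʳ : ∀ p → p ⊗ one ≃ p
⊗-identityʳ []      = ≃-refl
⊗-identityʳ (a ∷ p) =
  ≃-trans (⊕-cong ≃-refl (∷-cong refl (⊗-identityʳ p))) (≃-reflexive (sym (∷-as-⊕ a p)))

⊗-•one : ∀ p a → p ⊗ (a • one) ≃ a • p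
⊗-•one p true  = ⊗-identityʳ p
⊗-•one p false = ⊗-zeroʳ p

⊗-comm : ∀ p q → p ⊗ q ≃ q ⊗ p
⊗-comm []      q = ≃-sym (⊗-zeroʳ q)
⊗-comm (a ∷ p) q = begin
  a • q ⊕ (false ∷ p ⊗ q)               ≈⟨ ⊕-cong (≃-sym (⊗-•one q a)) (∷-cong refl (⊗-comm p q)) ⟩
  q ⊗ (a • one) ⊕ (false ∷ q ⊗ p)       ≈⟨ ⊕-cong {q ⊗ (a • one)} ≃-refl (⊗-shiftʳ q p) ⟨
  q ⊗ (a • one) ⊕ q ⊗ (false ∷ p)       ≈⟨ ⊗-distribˡ q (a • one) (false ∷ p) ⟨
  q ⊗ (a • one ⊕ (false ∷ p))           ≡⟨ cong (q ⊗_) (∷-as-⊕ a p) ⟨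
  q ⊗ (a ∷ p)                           ∎

⊗-assoc : ∀ p q r → (p ⊗ q) ⊗ r ≃ p ⊗ (q ⊗ r)
⊗-assoc []      q r = ≃-refl
⊗-assoc (a ∷ p) q r =
  ≃-trans (⊗-distribʳ (a • q) (false ∷ p ⊗ q) r)
          (⊕-cong (≃-reflexive (•-⊗ a q r)) (∷-cong refl (⊗-assoc p q r)))

polySemiring : CommutativeSemiring _ _
polySemiring = record
  { Carrier = Poly ; _≈_ = _≃_ ; _+_ = _⊕_ ; _*_ = _⊗_ ; 0# = [] ; 1# = one
  ; isCommutativeSemiring = isCommutativeSemiringˡ record
    { +-isCommutativeMonoid = ⊕-isCommutativeMonoid
    ; *-isCommutativeMonoid = record
      { isMonoid = record
        { isSemigroup = record
          { isMagma = record { isEquivalence = ≃-isEquivalence ; ∙-cong = ⊗-cong }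
          ; assoc   = ⊗-assoc }
        ; identity = ⊗-identityˡ , ⊗-identityʳ }
      ; comm = ⊗-comm }
    ; distribʳ = λ r p q → ⊗-distribʳ p q r
    ; zeroˡ    = λ _ → ≃-refl }
  }

open SemiringSolver polySemiring using (solve; _:+_; _:*_; _:=_; con)

-- Powers and the Frobenius map

^^-congˡ : ∀ {p q} n → p ≃ q → p ^^ n ≃ q ^^ n
^^-congˡ zero    h = ≃-refl
^^-congˡ (suc n) h = ⊗-cong h (^^-congˡ n h)

one-^^ : ∀ n → one ^^ n ≃ one
one-^^ zero    = ≃-refl
one-^^ (suc n) = ≃-trans (⊗-identityˡ _) (one-^^ n)

^^-homo-⊗ : ∀ p m n → p ^^ (m + n) ≃ p ^^ m ⊗ p ^^ n
^^-homo-⊗ p zero    n = ≃-sym (⊗-identityˡ _)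
^^-homo-⊗ p (suc m) n =
  ≃-trans (⊗-congʳ p (^^-homo-⊗ p m n)) (≃-sym (⊗-assoc p (p ^^ m) (p ^^ n)))

^^-assocʳ : ∀ p m n → (p ^^ m) ^^ n ≃ p ^^ (m * n)
^^-assocʳ p m zero    = ≃-reflexive (cong (p ^^_) (sym (*-zeroʳ m)))
^^-assocʳ p m (suc n) = begin
  p ^^ m ⊗ (p ^^ m) ^^ n   ≈⟨ ⊗-congʳ (p ^^ m) (^^-assocʳ p m n) ⟩
  p ^^ m ⊗ p ^^ (m * n)    ≈⟨ ^^-homo-⊗ p m (m * n) ⟨
  p ^^ (m + m * n)         ≡⟨ cong (p ^^_) (sym (*-suc m n)) ⟩
  p ^^ (m * suc n)         ∎

^^-distrib-⊗ : ∀ p q n → (p ⊗ q) ^^ n ≃ p ^^ n ⊗ q ^^ n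
^^-distrib-⊗ p q zero    = ≃-sym (⊗-identityˡ one)
^^-distrib-⊗ p q (suc n) = ≃-trans (⊗-congʳ (p ⊗ q) (^^-distrib-⊗ p q n))
  (solve 4 (λ p q p′ q′ → (p :* q) :* (p′ :* q′) := (p :* p′) :* (q :* q′)) ≃-refl p q (p ^^ n) (q ^^ n))

⊕-square : ∀ p q → (p ⊕ q) ⊗ (p ⊕ q) ≃ p ⊗ p ⊕ q ⊗ q
⊕-square p q = ≃-trans
  (solve 2 (λ p q → (p :+ q) :* (p :+ q) := (p :* q :+ p :* q) :+ (p :* p :+ q :* q)) ≃-refl p q)
  (⊕-self-⊕ (p ⊗ q) (p ⊗ p ⊕ q ⊗ q))

^^-2^-suc : ∀ p t → p ^^ (2 ^ suc t) ≃ p ^^ (2 ^ t) ⊗ p ^^ (2 ^ t)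
^^-2^-suc p t = ≃-trans (≃-reflexive (cong (λ n → p ^^ (2 ^ t + n)) (+-identityʳ (2 ^ t))))
                        (^^-homo-⊗ p (2 ^ t) (2 ^ t))

frobenius : ∀ t p q → (p ⊕ q) ^^ (2 ^ t) ≃ p ^^ (2 ^ t) ⊕ q ^^ (2 ^ t)
frobenius zero    p q =
  ≃-trans (⊗-identityʳ (p ⊕ q)) (⊕-cong (≃-sym (⊗-identityʳ p)) (≃-sym (⊗-identityʳ q)))
frobenius (suc t) p q = begin
  (p ⊕ q) ^^ (2 ^ suc t)                            ≈⟨ ^^-2^-suc (p ⊕ q) t ⟩
  (p ⊕ q) ^^ (2 ^ t) ⊗ (p ⊕ q) ^^ (2 ^ t)           ≈⟨ ⊗-cong (frobenius t p q) (frobenius t p q) ⟩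
  (p ^^ (2 ^ t) ⊕ q ^^ (2 ^ t)) ⊗ (p ^^ (2 ^ t) ⊕ q ^^ (2 ^ t))
                                                    ≈⟨ ⊕-square (p ^^ (2 ^ t)) (q ^^ (2 ^ t)) ⟩
  p ^^ (2 ^ t) ⊗ p ^^ (2 ^ t) ⊕ q ^^ (2 ^ t) ⊗ q ^^ (2 ^ t)
                                                    ≈⟨ ⊕-cong (^^-2^-suc p t) (^^-2^-suc q t) ⟨
  p ^^ (2 ^ suc t) ⊕ q ^^ (2 ^ suc t)               ∎

norm-≃ : ∀ p → norm p ≃ p
norm-≃ []      = ≃-refl
norm-≃ (a ∷ p) with norm p | norm-≃ p
... | []    | ih with a
...   | true  = ∷-cong refl ih
...   | false = ≃-sym (∷-≃[] refl (≃-sym ih))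
norm-≃ (a ∷ p) | _ ∷ _ | ih = ∷-cong refl ih

norm-length : ∀ p → length (norm p) ≤ length p
norm-length []      = z≤n
norm-length (a ∷ p) with norm p | norm-length p
... | []    | _ with a
...   | true  = s≤s z≤n
...   | false = z≤n
norm-length (a ∷ p) | _ ∷ _ | ih = s≤s ih

norm-≃[] : ∀ {p} → p ≃ [] → norm p ≡ []
norm-≃[] {[]}    h = refl
norm-≃[] {a ∷ p} h with norm p | norm-≃[] (∷-≃[]-tail h) | coeff-≡ h 0
... | [] | refl | refl = refl

≃⇒≈ : ∀ {p q} → p ≃ q → p ≈ q
≃⇒≈ {[]}             h = sym (norm-≃[] (≃-sym h))
≃⇒≈ {a ∷ p} {[]}     h = norm-≃[] h
≃⇒≈ {a ∷ p} {b ∷ q} h with norm p | norm q | ≃⇒≈ (∷-injectiveʳ h) | coeff-≡ h 0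
... | []    | _ | refl | refl = refl
... | _ ∷ _ | _ | refl | refl = refl

≈⇒≃ : ∀ {p q} → p ≈ q → p ≃ q
≈⇒≃ {p} {q} h = ≃-trans (≃-sym (norm-≃ p)) (≃-trans (≃-reflexive h) (norm-≃ q))

eval : Bool → Poly → Bool
eval c []      = false
eval c (a ∷ p) = a xor (c ∧ eval c p)

open CommutativeSemigroupProperties (CommutativeRing.+-commutativeSemigroup xor-∧-commutativeRing)
  using () renaming (interchange to xor-interchange)

eval-⊕ : ∀ c p q → eval c (p ⊕ q) ≡ eval c p xor eval c q
eval-⊕ c []      q       = refl
eval-⊕ c (a ∷ p) []      = sym (xor-identityʳ _)
eval-⊕ c (a ∷ p) (b ∷ q) =
  trans (cong (λ v → (a xor b) xor (c ∧ v)) (eval-⊕ c p q))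
  (trans (cong ((a xor b) xor_) (∧-distribˡ-xor c (eval c p) (eval c q)))
         (xor-interchange a b (c ∧ eval c p) (c ∧ eval c q)))

eval-• : ∀ c a q → eval c (a • q) ≡ a ∧ eval c q
eval-• c true  q = refl
eval-• c false q = refl

eval-⊗ : ∀ c p q → eval c (p ⊗ q) ≡ eval c p ∧ eval c q
eval-⊗ c []      q = refl
eval-⊗ c (a ∷ p) q =
  trans (eval-⊕ c (a • q) (false ∷ p ⊗ q))
  (trans (cong₂ (λ u v → u xor (c ∧ v)) (eval-• c a q) (eval-⊗ c p q))
  (trans (cong ((a ∧ eval c q) xor_) (sym (∧-assoc c (eval c p) (eval c q))))
         (sym (∧-distribʳ-xor (eval c q) a (c ∧ eval c p)))))

eval-norm : ∀ c p → eval c (norm p) ≡ eval c p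
eval-norm c []      = refl
eval-norm c (a ∷ p) with norm p | eval-norm c p
... | []    | ih with a
...   | true  = cong (λ v → true xor (c ∧ v)) ih
...   | false = trans (sym (∧-zeroʳ c)) (cong (c ∧_) ih)
eval-norm c (a ∷ p) | _ ∷ _ | ih = cong (λ v → a xor (c ∧ v)) ih

eval-cong : ∀ c {p q} → p ≃ q → eval c p ≡ eval c q
eval-cong c {p} {q} h = trans (sym (eval-norm c p)) (trans (cong (eval c) (≃⇒≈ h)) (eval-norm c q))

X X+1 M+1 : Poly
X   = false ∷ true ∷ []
X+1 = true ∷ true ∷ []
M+1 = false ∷ true ∷ true ∷ []

X⊗-≃ : ∀ p → X ⊗ p ≃ false ∷ p
X⊗-≃ p = ∷-cong refl (⊗-identityˡ p)

Regular : Poly → Set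
Regular r = ∀ {p} → r ⊗ p ≃ [] → p ≃ []

X-regular : Regular X
X-regular {p} h = ∷-≃[]-tail (≃-trans (≃-sym (X⊗-≃ p)) h)

X+1-regular : Regular X+1
X+1-regular {p} h = shift-regular p (≃-trans (⊕-cong ≃-refl (≃-sym (X⊗-≃ p))) h)
  where
  shift-regular : ∀ p → p ⊕ (false ∷ p) ≃ [] → p ≃ []
  shift-regular []      _ = ≃-refl
  shift-regular (a ∷ p) h with trans (sym (xor-identityʳ a)) (coeff-≡ h 0)
  ... | refl = ∷-≃[] refl (shift-regular p (∷-≃[]-tail h))

⊗-regular : ∀ {r s} → Regular r → Regular s → Regular (r ⊗ s)
⊗-regular {r} {s} r-reg s-reg {p} h = s-reg (r-reg (≃-trans (≃-sym (⊗-assoc r s p)) h))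

^^-regular : ∀ {r} → Regular r → ∀ n → Regular (r ^^ n)
^^-regular r-reg zero    h = ≃-trans (≃-sym (⊗-identityˡ _)) h
^^-regular {r} r-reg (suc n) h = ⊗-regular {r} {r ^^ n} r-reg (^^-regular r-reg n) h

M+1-regular : Regular M+1
M+1-regular = ⊗-regular {X} {X+1} X-regular X+1-regular

regular-cancelˡ : ∀ {r p q} → Regular r → r ⊗ p ≃ r ⊗ q → p ≃ q
regular-cancelˡ {r} {p} {q} r-reg h = ⊕-≃[]⇒≃ (r-reg (begin
  r ⊗ (p ⊕ q)       ≈⟨ ⊗-distribˡ r p q ⟩
  r ⊗ p ⊕ r ⊗ q     ≈⟨ ⊕-cong h ≃-refl ⟩
  r ⊗ q ⊕ r ⊗ q     ≈⟨ ⊕-self (r ⊗ q) ⟩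
  []                ∎))

-- Stripping the factors x and x + 1

divX1-length : ∀ acc a p → length (proj₁ (divX1 acc (a ∷ p))) ≡ length p
divX1-length acc a []      = refl
divX1-length acc a (b ∷ p) with divX1 (acc xor a) (b ∷ p) | divX1-length (acc xor a) b p
... | _ , _ | ih = cong suc ih

divX1-remainder : ∀ acc a p → proj₂ (divX1 acc (a ∷ p)) ≡ acc xor eval true (a ∷ p)
divX1-remainder acc a []      = cong (acc xor_) (sym (xor-identityʳ a))
divX1-remainder acc a (b ∷ p) with divX1 (acc xor a) (b ∷ p) | divX1-remainder (acc xor a) b p
... | _ , _ | ih = trans ih (xor-assoc acc a _)

•one-⊕-∷ : ∀ c a p → c • one ⊕ (a ∷ p) ≡ (c xor a) ∷ p
•one-⊕-∷ true  a p = refl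
•one-⊕-∷ false a p = refl

divX1-exact : ∀ acc a p → proj₂ (divX1 acc (a ∷ p)) ≡ false →
              acc • one ⊕ (a ∷ p) ≃ X+1 ⊗ proj₁ (divX1 acc (a ∷ p))
divX1-exact acc a [] r≡false =
  ≃-trans (≃-reflexive (•one-⊕-∷ acc a [])) (≃-trans (∷-≃[] r≡false ≃-refl) (≃-sym (⊗-zeroʳ X+1)))
divX1-exact acc a (b ∷ p) with divX1 (acc xor a) (b ∷ p) | divX1-exact (acc xor a) b p
... | q , r | ih = λ r≡false → begin
  acc • one ⊕ (a ∷ b ∷ p)            ≡⟨ •one-⊕-∷ acc a (b ∷ p) ⟩
  c ∷ b ∷ p                          ≡⟨ ∷-as-⊕ c (b ∷ p) ⟩
  c • one ⊕ (false ∷ b ∷ p)          ≈⟨ ⊕-cong ≃-refl (≃-sym (X⊗-≃ (b ∷ p))) ⟩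
  c • one ⊕ X ⊗ (b ∷ p)              ≈⟨ ⊕-cong ≃-refl (⊗-congʳ X (⊕-moveˡ {c • one} (ih r≡false))) ⟩
  c • one ⊕ X ⊗ (c • one ⊕ X+1 ⊗ q)  ≈⟨ solve 3 (λ c x q → c :+ x :* (c :+ (con 1 :+ x) :* q)
                                                  := (con 1 :+ x) :* (c :+ x :* q)) ≃-refl (c • one) X q ⟩
  X+1 ⊗ (c • one ⊕ X ⊗ q)            ≈⟨ ⊗-congʳ X+1 (⊕-cong ≃-refl (X⊗-≃ q)) ⟩
  X+1 ⊗ (c • one ⊕ (false ∷ q))      ≡⟨ cong (X+1 ⊗_) (∷-as-⊕ c q) ⟨
  X+1 ⊗ (c ∷ q)                      ∎
  where c = acc xor a

NoRootInF₂ : Poly → Set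
NoRootInF₂ Q = eval false Q ≡ true × eval true Q ≡ true

noRoot-cong : ∀ {p q} → p ≃ q → NoRootInF₂ p → NoRootInF₂ q
noRoot-cong h (p₀ , p₁) = trans (sym (eval-cong false h)) p₀ , trans (sym (eval-cong true h)) p₁

factored : ℕ → ℕ → Poly → Poly
factored a b Q = X ^^ a ⊗ X+1 ^^ b ⊗ Q

factored-suc : ∀ a b Q → factored (suc a) b Q ≃ false ∷ factored a b Q
factored-suc a b Q = ≃-trans
  (solve 4 (λ x xᵃ yᵇ q → x :* xᵃ :* yᵇ :* q := x :* (xᵃ :* yᵇ :* q)) ≃-refl X (X ^^ a) (X+1 ^^ b) Q)
  (X⊗-≃ (factored a b Q))

factored-zero-suc : ∀ b Q → factored 0 (suc b) Q ≃ X+1 ⊗ factored 0 b Q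
factored-zero-suc b Q =
  solve 4 (λ o y yᵇ q → o :* (y :* yᵇ) :* q := y :* (o :* yᵇ :* q)) ≃-refl one X+1 (X+1 ^^ b) Q

factored-zero-zero : ∀ Q → factored 0 0 Q ≃ Q
factored-zero-zero Q = ≃-trans (⊗-congˡ Q (⊗-identityˡ one)) (⊗-identityˡ Q)

eval₀-factored-zero : ∀ b Q → eval false (factored 0 b Q) ≡ eval false Q
eval₀-factored-zero zero    Q = eval-cong false (factored-zero-zero Q)
eval₀-factored-zero (suc b) Q = trans (eval-cong false (factored-zero-suc b Q))
                                (trans (eval-⊗ false X+1 (factored 0 b Q)) (eval₀-factored-zero b Q))

eval-mismatch : ∀ c {p q} → p ≃ q → eval c p ≡ true → eval c q ≡ false → ⊥
eval-mismatch c h p-true q-false with trans (sym p-true) (trans (eval-cong c h) q-false)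
... | ()

factored-nonzero : ∀ a b {Q} → eval false Q ≡ true → ¬ factored a b Q ≃ []
factored-nonzero a b Q₀ h = eval-mismatch false (xᵃyᵇ-regular h) Q₀ refl
  where
  xᵃyᵇ-regular : Regular (X ^^ a ⊗ X+1 ^^ b)
  xᵃyᵇ-regular = ⊗-regular {X ^^ a} (^^-regular X-regular a) (^^-regular X+1-regular b)

-- Each round of stripFuel is forced: a root at 0 means a > 0, otherwise a root at 1 means b > 0.
stripFuel-factored : ∀ f a b {p Q} → NoRootInF₂ Q → length p ≤ f → p ≃ factored a b Q →
                     stripFuel f p ≃ Q
stripFuel-factored zero a b {[]} (Q₀ , _) _ h = ⊥-elim (factored-nonzero a b Q₀ (≃-sym h))
stripFuel-factored (suc f) a b {p} {Q} Q° len h with norm p | ≃-trans (norm-≃ p) h | norm-length p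
... | [] | n≃ | _ = ⊥-elim (factored-nonzero a b (proj₁ Q°) (≃-sym n≃))
stripFuel-factored (suc f) zero b {p} {Q} Q° len h | false ∷ r | n≃ | _ =
  ⊥-elim (eval-mismatch false (≃-sym n≃) (trans (eval₀-factored-zero b Q) (proj₁ Q°)) refl)
stripFuel-factored (suc f) (suc a) b {p} {Q} Q° len h | false ∷ r | n≃ | n-len =
  stripFuel-factored f a b Q° (≤-pred (≤-trans n-len len)) (∷-injectiveʳ (≃-trans n≃ (factored-suc a b Q)))
stripFuel-factored (suc f) (suc a) b {p} {Q} Q° len h | true ∷ q | n≃ | _ =
  ⊥-elim (eval-mismatch false (≃-trans n≃ (factored-suc a b Q)) refl refl)
stripFuel-factored (suc f) zero b {p} {Q} Q° len h | true ∷ q | n≃ | n-len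
  with divX1 false (true ∷ q) | divX1-remainder false true q | divX1-exact false true q
     | divX1-length false true q
... | d , true | rem | _ | _ with b
...   | zero  = ≃-trans n≃ (factored-zero-zero Q)
...   | suc b = ⊥-elim (eval-mismatch true (≃-trans n≃ (factored-zero-suc b Q)) (sym rem)
                                     (eval-⊗ true X+1 (factored 0 b Q)))
stripFuel-factored (suc f) zero b {p} {Q} Q° len h | true ∷ q | n≃ | n-len
    | d , false | rem | exact | d-len with b
...   | zero  = ⊥-elim (eval-mismatch true (≃-sym (≃-trans n≃ (factored-zero-zero Q))) (proj₂ Q°) (sym rem))
...   | suc b = stripFuel-factored f zero b Q° (subst (_≤ f) (sym d-len) (≤-pred (≤-trans n-len len)))
                  (regular-cancelˡ {X+1} X+1-regular
                    (≃-trans (≃-sym (exact refl)) (≃-trans n≃ (factored-zero-suc b Q))))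

strip-M+1^ : ∀ n {p Q} → NoRootInF₂ Q → p ≃ M+1 ^^ n ⊗ Q → strip p ≃ Q
strip-M+1^ n {p} {Q} Q° h =
  stripFuel-factored (length p) n n Q° ≤-refl (≃-trans h (⊗-congˡ Q (^^-distrib-⊗ X X+1 n)))

-- Collatz trajectories

Ω : ℕ → ℕ → Poly
Ω j e = one ⊕ M+1 ^^ j ⊗ M ^^ e

one⊕M+1⊗-noRoot : ∀ s → NoRootInF₂ (one ⊕ M+1 ⊗ s)
one⊕M+1⊗-noRoot s = trans (eval-⊕ false one (M+1 ⊗ s)) (cong (true xor_) (eval-⊗ false M+1 s))
                  , trans (eval-⊕ true one (M+1 ⊗ s)) (cong (true xor_) (eval-⊗ true M+1 s))

Ω-suc-noRoot : ∀ j e → NoRootInF₂ (Ω (suc j) e)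
Ω-suc-noRoot j e = noRoot-cong (⊕-cong {one} ≃-refl (≃-sym (⊗-assoc M+1 (M+1 ^^ j) (M ^^ e))))
                               (one⊕M+1⊗-noRoot (M+1 ^^ j ⊗ M ^^ e))

eval₀-M^^ : ∀ e → eval false (M ^^ e) ≡ true
eval₀-M^^ zero    = refl
eval₀-M^^ (suc e) = trans (eval-⊗ false M (M ^^ e)) (eval₀-M^^ e)

Ω-suc-≄-one : ∀ j e → ¬ Ω (suc j) e ≃ one
Ω-suc-≄-one j e h = eval-mismatch false Mᵉ≃[] (eval₀-M^^ e) refl
  where
  Mᵉ≃[] : M ^^ e ≃ []
  Mᵉ≃[] = ^^-regular {M+1} M+1-regular (suc j) (≃-trans (⊕-moveˡ {one} h) (⊕-self one))

Ω-step : ∀ j e → one ⊕ M ⊗ Ω (suc j) e ≃ M+1 ⊗ Ω j (suc e)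
Ω-step j e = ≃-trans
  (solve 3 (λ w z y → con 1 :+ (con 1 :+ w) :* (con 1 :+ w :* z :* y)
                   := (con 1 :+ con 1) :+ w :* (con 1 :+ z :* ((con 1 :+ w) :* y)))
           ≃-refl M+1 (M+1 ^^ j) (M ^^ e))
  (⊕-self-⊕ one (M+1 ⊗ Ω j (suc e)))

M^2^ : ∀ t → M ^^ (2 ^ t) ≃ one ⊕ M+1 ^^ (2 ^ t)
M^2^ t = ≃-trans (frobenius t one M+1) (⊕-cong (one-^^ (2 ^ t)) ≃-refl)

Ω-zero-2^ : ∀ t → Ω 0 (2 ^ t) ≃ M+1 ^^ (2 ^ t)
Ω-zero-2^ t = begin
  one ⊕ one ⊗ M ^^ (2 ^ t)        ≈⟨ ⊕-cong {one} ≃-refl (≃-trans (⊗-identityˡ (M ^^ (2 ^ t))) (M^2^ t)) ⟩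
  one ⊕ (one ⊕ M+1 ^^ (2 ^ t))    ≡⟨ ⊕-assoc one one (M+1 ^^ (2 ^ t)) ⟨
  (one ⊕ one) ⊕ M+1 ^^ (2 ^ t)    ≈⟨ ⊕-self-⊕ one (M+1 ^^ (2 ^ t)) ⟩
  M+1 ^^ (2 ^ t)                  ∎

oddTerm-Ω : ∀ k j {e A} → A ≃ Ω (k + suc j) e → oddTerm k A ≃ Ω (suc j) (k + e)
oddTerm-Ω zero    j {e} h = strip-M+1^ 0 (Ω-suc-noRoot j e) (≃-trans h (≃-sym (⊗-identityˡ _)))
oddTerm-Ω (suc k) j {e} {A} h = strip-M+1^ 1 (Ω-suc-noRoot j (suc k + e)) (begin
  one ⊕ M ⊗ oddTerm k A               ≈⟨ ⊕-cong {one} ≃-refl (⊗-congʳ M (oddTerm-Ω k (suc j) {e} h′)) ⟩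
  one ⊕ M ⊗ Ω (suc (suc j)) (k + e)   ≈⟨ Ω-step (suc j) (k + e) ⟩
  M+1 ⊗ Ω (suc j) (suc k + e)         ≈⟨ ⊗-congˡ (Ω (suc j) (suc k + e)) (⊗-identityʳ M+1) ⟨
  M+1 ^^ 1 ⊗ Ω (suc j) (suc k + e)    ∎)
  where
  h′ : A ≃ Ω (k + suc (suc j)) e
  h′ = subst (λ i → A ≃ Ω i e) (sym (+-suc k (suc j))) h

collatzLength-Ω : ∀ {A} i e t → 1 ≤ i → A ≃ Ω i e → i + e ≡ 2 ^ t → CollatzLength A (suc i)
collatzLength-Ω {A} (suc i) e t _ h i+e≡2^t = suc i , refl , ≃⇒≈ last , earlier
  where
  last : oddTerm (suc i) A ≃ one
  last = strip-M+1^ (suc (2 ^ t)) (refl , refl) (begin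
    one ⊕ M ⊗ oddTerm i A      ≈⟨ ⊕-cong {one} ≃-refl (⊗-congʳ M (oddTerm-Ω i 0 {e} h′)) ⟩
    one ⊕ M ⊗ Ω 1 (i + e)      ≈⟨ Ω-step 0 (i + e) ⟩
    M+1 ⊗ Ω 0 (suc i + e)      ≡⟨ cong (λ n → M+1 ⊗ Ω 0 n) i+e≡2^t ⟩
    M+1 ⊗ Ω 0 (2 ^ t)          ≈⟨ ⊗-congʳ M+1 (Ω-zero-2^ t) ⟩
    M+1 ^^ suc (2 ^ t)         ≈⟨ ⊗-identityʳ (M+1 ^^ suc (2 ^ t)) ⟨
    M+1 ^^ suc (2 ^ t) ⊗ one   ∎)
    where
    h′ : A ≃ Ω (i + 1) e
    h′ = subst (λ n → A ≃ Ω n e) (sym (+-comm i 1)) h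
  earlier : ∀ k → k < suc i → ¬ oddTerm k A ≈ one
  earlier k (s≤s k≤i) eq =
    Ω-suc-≄-one (i ∸ k) (k + e) (≃-trans (≃-sym (oddTerm-Ω k (i ∸ k) {e} h′)) (≈⇒≃ eq))
    where
    h′ : A ≃ Ω (k + suc (i ∸ k)) e
    h′ = subst (λ n → A ≃ Ω n e) (sym (trans (+-suc k (i ∸ k)) (cong suc (m+[n∸m]≡n k≤i)))) h

M+1⊗geomM : ∀ n → M+1 ⊗ geomM n ≃ M ^^ suc n ⊕ one
M+1⊗geomM zero    = ≃-trans (⊗-identityʳ M+1) (⊕-cong {q = one} (≃-sym (⊗-identityʳ M)) ≃-refl)
M+1⊗geomM (suc n) = begin
  M+1 ⊗ (M ^^ suc n ⊕ geomM n)            ≈⟨ ⊗-distribˡ M+1 (M ^^ suc n) (geomM n) ⟩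
  M+1 ⊗ M ^^ suc n ⊕ M+1 ⊗ geomM n        ≈⟨ ⊕-cong {M+1 ⊗ M ^^ suc n} ≃-refl (M+1⊗geomM n) ⟩
  M+1 ⊗ M ^^ suc n ⊕ (M ^^ suc n ⊕ one)   ≈⟨ solve 2 (λ w y → w :* y :+ (y :+ con 1) := (con 1 :+ w) :* y :+ con 1)
                                                      ≃-refl M+1 (M ^^ suc n) ⟩
  M ^^ suc (suc n) ⊕ one                  ∎

geomM-suc : ∀ n → M ^^ suc n ≃ one ⊕ M+1 ^^ suc n → geomM (suc n) ≃ one ⊕ M+1 ^^ n ⊗ M
geomM-suc n h = regular-cancelˡ {M+1} M+1-regular (begin
  M+1 ⊗ geomM (suc n)                      ≈⟨ M+1⊗geomM (suc n) ⟩
  M ⊗ M ^^ suc n ⊕ one                     ≈⟨ ⊕-cong {q = one} (⊗-congʳ M h) ≃-refl ⟩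
  M ⊗ (one ⊕ M+1 ⊗ M+1 ^^ n) ⊕ one         ≈⟨ solve 2 (λ w v → (con 1 :+ w) :* (con 1 :+ w :* v) :+ con 1
                                                       := (con 1 :+ con 1) :+ w :* (con 1 :+ v :* (con 1 :+ w)))
                                                       ≃-refl M+1 (M+1 ^^ n) ⟩
  (one ⊕ one) ⊕ M+1 ⊗ (one ⊕ M+1 ^^ n ⊗ M) ≈⟨ ⊕-self-⊕ one (M+1 ⊗ (one ⊕ M+1 ^^ n ⊗ M)) ⟩
  M+1 ⊗ (one ⊕ M+1 ^^ n ⊗ M)               ∎)

geomM-2^ : ∀ r → geomM (2 ^ r) ≃ one ⊕ M+1 ^^ (2 ^ r ∸ 1) ⊗ M
geomM-2^ r = subst (λ n → geomM n ≃ one ⊕ M+1 ^^ (2 ^ r ∸ 1) ⊗ M) 1+[2^r∸1]≡2^r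
  (geomM-suc (2 ^ r ∸ 1) (subst (λ n → M ^^ n ≃ one ⊕ M+1 ^^ n) (sym 1+[2^r∸1]≡2^r) (M^2^ r)))
  where
  1+[2^r∸1]≡2^r : suc (2 ^ r ∸ 1) ≡ 2 ^ r
  1+[2^r∸1]≡2^r = m+[n∸m]≡n (m^n>0 2 r)

geomM[2^r]^^2^u≃Ω : ∀ r u → geomM (2 ^ r) ^^ (2 ^ u) ≃ Ω (2 ^ u * (2 ^ r ∸ 1)) (2 ^ u)
geomM[2^r]^^2^u≃Ω r u = begin
  geomM (2 ^ r) ^^ N                   ≈⟨ ^^-congˡ N (geomM-2^ r) ⟩
  (one ⊕ M+1 ^^ R′ ⊗ M) ^^ N           ≈⟨ frobenius u one (M+1 ^^ R′ ⊗ M) ⟩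
  one ^^ N ⊕ (M+1 ^^ R′ ⊗ M) ^^ N      ≈⟨ ⊕-cong (one-^^ N) (^^-distrib-⊗ (M+1 ^^ R′) M N) ⟩
  one ⊕ (M+1 ^^ R′) ^^ N ⊗ M ^^ N      ≈⟨ ⊕-cong {one} ≃-refl (⊗-congˡ (M ^^ N) (^^-assocʳ M+1 R′ N)) ⟩
  one ⊕ M+1 ^^ (R′ * N) ⊗ M ^^ N       ≡⟨ cong (λ n → Ω n N) (*-comm R′ N) ⟩
  Ω (N * R′) N                         ∎
  where
  N R′ : ℕ
  N  = 2 ^ u
  R′ = 2 ^ r ∸ 1

lemma3p2 : (r u : ℕ) → r ≥ 1 → u ≥ 1 →
    CollatzLength (geomM (2 ^ r) ^^ (2 ^ u)) (2 ^ u * (2 ^ r ∸ 1) + 1)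
lemma3p2 r u r≥1 _ = subst (CollatzLength (geomM (2 ^ r) ^^ N)) (+-comm 1 m)
  (collatzLength-Ω m N (u + r) m≥1 (geomM[2^r]^^2^u≃Ω r u) m+N≡2^[u+r])
  where
  N m : ℕ
  N = 2 ^ u
  m = N * (2 ^ r ∸ 1)
  m≥1 : m ≥ 1
  m≥1 = *-mono-≤ (m^n>0 2 u) (∸-monoˡ-≤ 1 (^-monoʳ-≤ 2 r≥1))
  m+N≡2^[u+r] : m + N ≡ 2 ^ (u + r)
  m+N≡2^[u+r] = trans (+-comm m N) (trans (sym (*-suc N (2 ^ r ∸ 1)))
                (trans (cong (N *_) (m+[n∸m]≡n (m^n>0 2 r))) (sym (^-distribˡ-+-* 2 u r))))
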